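{- Let $k\ge 2$ and $1\le p_1\le\cdots\le p_k$ be integers with $p_2\ge 2$, and let $\Theta=\Theta(p_1,\ldots,p_k)$. Then $\mu_{\rm t}(\Theta)=0$ if and only if one of the following holds: (i) $p_1=1$ and $p_2\ge 4$; (ii) $p_1=2$ and $p_2\ge 3$; (iii) $p_1\ge 3$.
   Context: The theta graph $\Theta(p_1,\ldots,p_k)$ (with $k\ge2$, $1\le p_1\le\cdots\le p_k$, $p_2\ge 2$) consists of two vertices $a$ and $b$ joined by $k$ internally disjoint paths of lengths $p_1,\ldots,p_k$. For a connected graph $G$ and $X\subseteq V(G)$, two vertices $x,y$ are $X$-visible if there is a shortest $x,y$-path $P$ with $V(P)\cap X\subseteq\{x,y\}$; $X$ is a total mutual-visibility set if every pair of vertices of $G$ is $X$-visible. $\mu_{\rm t}(G)$ is the largest cardinality of a total mutual-visibility set of $G$. -}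

module Defs where

open import Data.Nat using (ℕ; zero; suc; _≤_; _∸_; s≤s; z≤n)
open import Data.Fin as Fin using (Fin; toℕ)
open import Data.List using (List; []; _∷_; length)
open import Data.List.Membership.Propositional using (_∈_)
open import Data.List.Relation.Unary.Unique.Propositional using (Unique)
open import Data.Product using (Σ; ∃; _×_; _,_)
open import Data.Sum using (_⊎_)
open import Relation.Binary.PropositionalEquality using (_≡_)

record Graph : Set₁ where
  field
    V : Set
    E : V → V → Set
open Graph public

data Walk (G : Graph) : V G → V G → Set where
  []  : ∀ {x} → Walk G x x
  _∷_ : ∀ {x y z} → E G x y → Walk G y z → Walk G x z

walkLength : ∀ {G x y} → Walk G x y → ℕ
walkLength []      = 0
walkLength (_ ∷ w) = suc (walkLength w)

vertices : ∀ {G x y} → Walk G x y → List (V G)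
vertices {x = x} []      = x ∷ []
vertices {x = x} (_ ∷ w) = x ∷ vertices w

IsPath : ∀ {G x y} → Walk G x y → Set
IsPath w = Unique (vertices w)

IsShortestPath : ∀ {G x y} → Walk G x y → Set
IsShortestPath {G} {x} {y} w =
  IsPath w × ((w' : Walk G x y) → walkLength w ≤ walkLength w')

Visible : (G : Graph) → List (V G) → V G → V G → Set
Visible G X x y =
  Σ (Walk G x y) λ P → IsShortestPath P ×
    (∀ v → v ∈ vertices P → v ∈ X → (v ≡ x ⊎ v ≡ y))

-- X is a total mutual-visibility set: every pair of vertices is X-visible
-- (vertex subsets are duplicate-free lists; cardinality = length)
IsTotalMutualVisibilitySet : (G : Graph) → List (V G) → Set
IsTotalMutualVisibilitySet G X = Unique X × (∀ x y → Visible G X x y)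

MuT≡ : Graph → ℕ → Set
MuT≡ G m =
  (Σ (List (V G)) λ X → IsTotalMutualVisibilitySet G X × length X ≡ m) ×
  (∀ X → IsTotalMutualVisibilitySet G X → length X ≤ m)

-- vertices: a, b, and the p_i - 1 internal vertices of the i-th path
data ThetaV {k : ℕ} (p : Fin k → ℕ) : Set where
  va vb : ThetaV p
  inner : (i : Fin k) → Fin (p i ∸ 1) → ThetaV p

-- OnPath p i v n : vertex v lies on the i-th a,b-path at distance n from a
data OnPath {k : ℕ} (p : Fin k → ℕ) (i : Fin k) : ThetaV p → ℕ → Set where
  onA     : OnPath p i va 0
  onB     : OnPath p i vb (p i)
  onInner : (j : Fin (p i ∸ 1)) → OnPath p i (inner i j) (suc (toℕ j))

ThetaAdj : {k : ℕ} (p : Fin k → ℕ) → ThetaV p → ThetaV p → Set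
ThetaAdj p u v = ∃ λ i → ∃ λ n →
  (OnPath p i u n × OnPath p i v (suc n)) ⊎ (OnPath p i v n × OnPath p i u (suc n))

Theta : {k : ℕ} → (Fin k → ℕ) → Graph
Theta p = record { V = ThetaV p ; E = ThetaAdj p }

first second : ∀ {k} → 2 ≤ k → Fin k
first  (s≤s (s≤s _)) = Fin.zero
second (s≤s (s≤s _)) = Fin.suc Fin.zero

-- Given 1 ≤ p₁ and 2 ≤ p₂, conditions (i)–(iii) say exactly that p₁ + p₂ ≥ 5.
--
-- If p₁ + p₂ ≥ 5, every vertex v has two neighbours x, y whose distance in Θ − v is at least 3, as
-- witnessed by a function F that is 1-Lipschitz on Θ − v with F y ≥ F x + 3. So v lies on every
-- shortest x,y-path, hence in no total mutual-visibility set, and μ_t(Θ) = 0 because the empty set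
-- always qualifies.
--
-- If p₁ + p₂ ≤ 4, the vertex v next to a on a suitable path has just two neighbours, and they are
-- joined by a walk of length ≤ 2 avoiding v. Every walk can then be rerouted around v without getting
-- longer, so {v} is a total mutual-visibility set and μ_t(Θ) ≥ 1.

module Submission where

open import Defs
open import Data.Nat using (ℕ; zero; suc; _+_; _∸_; _⊓_; _≤_; _≥_; _<_; z≤n; s≤s; _≤?_; _<?_)
open import Data.Nat.Properties
open import Data.Fin as Fin using (Fin; toℕ; fromℕ<)
open import Data.Fin.Properties using (fromℕ<-toℕ; toℕ-fromℕ<; toℕ<n) renaming (_≟_ to _≟ᶠ_)
open import Data.List using (List; []; _∷_; map; allFin; length)
open import Data.List.Membership.Propositional using (_∈_; find; lose)
open import Data.List.Membership.Propositional.Properties using (∈-map⁺; ∈-map⁻; ∈-allFin)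
open import Data.List.Relation.Unary.Any using (here; there; any?)
open import Data.List.Relation.Unary.All as All using ()
open import Data.List.Relation.Unary.AllPairs as AllPairs using ()
open import Data.Product as Product using (Σ; ∃₂; _×_; _,_; proj₁; proj₂)
open import Data.Sum as Sum using (_⊎_; inj₁; inj₂; [_,_]′)
open import Data.Empty using (⊥; ⊥-elim)
open import Relation.Nullary using (¬_; Dec; yes; no)
open import Relation.Binary.PropositionalEquality
  using (_≡_; _≢_; refl; sym; trans; cong; subst; module ≡-Reasoning)
open import Relation.Binary.Definitions using (DecidableEquality)
open import Function.Bundles using (_⇔_; mk⇔)
open import Data.Nat.Tactic.RingSolver using (solve-∀)
import Function.Properties.Equivalence as ⇔

module Walks (G : Graph) where

  infixr 5 _++ʷ_

  _++ʷ_ : ∀ {x y z} → Walk G x y → Walk G y z → Walk G x z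
  []      ++ʷ w′ = w′
  (e ∷ w) ++ʷ w′ = e ∷ (w ++ʷ w′)

  walkLength-++ : ∀ {x y z} (w : Walk G x y) (w′ : Walk G y z) →
                  walkLength (w ++ʷ w′) ≡ walkLength w + walkLength w′
  walkLength-++ []      w′ = refl
  walkLength-++ (e ∷ w) w′ = cong suc (walkLength-++ w w′)

  ∈-vertices-++⁻ : ∀ {x y z u} (w : Walk G x y) (w′ : Walk G y z) →
                   u ∈ vertices (w ++ʷ w′) → u ∈ vertices w ⊎ u ∈ vertices w′
  ∈-vertices-++⁻ []      w′ u∈       = inj₂ u∈
  ∈-vertices-++⁻ (e ∷ w) w′ (here u≡) = inj₁ (here u≡)
  ∈-vertices-++⁻ (e ∷ w) w′ (there u∈) = Sum.map₁ there (∈-vertices-++⁻ w w′ u∈)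

  source∈vertices : ∀ {x y} (w : Walk G x y) → x ∈ vertices w
  source∈vertices []      = here refl
  source∈vertices (_ ∷ _) = here refl

  suffix : ∀ {x y u} (w : Walk G x y) → u ∈ vertices w →
           Σ (Walk G u y) λ s → walkLength s ≤ walkLength w
  suffix []      (here refl) = [] , z≤n
  suffix (e ∷ w) (here refl) = e ∷ w , ≤-refl
  suffix (e ∷ w) (there u∈)  = Product.map₂ m≤n⇒m≤1+n (suffix w u∈)

  Avoids : V G → ∀ {x y} → Walk G x y → Set
  Avoids v w = ∀ u → u ∈ vertices w → u ≢ v

  IsMinimal : ∀ {x y} → Walk G x y → Set
  IsMinimal {x} {y} w = (w′ : Walk G x y) → walkLength w ≤ walkLength w′

  minimal⇒path : ∀ {x y} (w : Walk G x y) → IsMinimal w → IsPath w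
  minimal⇒path []              _   = All.[] AllPairs.∷ AllPairs.[]
  minimal⇒path {x} (e ∷ w) min =
    All.tabulate source-not-revisited AllPairs.∷ minimal⇒path w (λ w′ → ≤-pred (min (e ∷ w′)))
    where
    source-not-revisited : ∀ {u} → u ∈ vertices w → x ≢ u
    source-not-revisited u∈ refl with suffix w u∈
    ... | s , s≤w = <-irrefl refl (≤-trans (s≤s s≤w) (min s))

  minimal⇒shortestPath : ∀ {x y} (w : Walk G x y) → IsMinimal w → IsShortestPath w
  minimal⇒shortestPath w min = minimal⇒path w min , min

  lipschitz-bound : (F : V G → ℕ) (P : V G → Set) →
    (∀ {u w} → E G u w → P u → P w → F w ≤ suc (F u)) →
    ∀ {x y} (w : Walk G x y) → (∀ u → u ∈ vertices w → P u) → F y ≤ F x + walkLength w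
  lipschitz-bound F P lip {x} []      _   = m≤m+n (F x) 0
  lipschitz-bound F P lip {x} {y} (_∷_ {y = z} e w) all-P = begin
    F y                      ≤⟨ lipschitz-bound F P lip w (λ u u∈ → all-P u (there u∈)) ⟩
    F z + walkLength w       ≤⟨ +-monoˡ-≤ (walkLength w) (lip e (all-P x (here refl))
                                                          (all-P z (there (source∈vertices w)))) ⟩
    suc (F x) + walkLength w ≡⟨ +-suc (F x) (walkLength w) ⟨
    F x + suc (walkLength w) ∎
    where open ≤-Reasoning

  module Undirected (adj-sym : ∀ {x y} → E G x y → E G y x) where

    reverse : ∀ {x y} → Walk G x y → Walk G y x
    reverse []      = []
    reverse (e ∷ w) = reverse w ++ʷ (adj-sym e ∷ [])

    walkLength-reverse : ∀ {x y} (w : Walk G x y) → walkLength (reverse w) ≡ walkLength w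
    walkLength-reverse []      = refl
    walkLength-reverse (e ∷ w) = begin
      walkLength (reverse w ++ʷ (adj-sym e ∷ [])) ≡⟨ walkLength-++ (reverse w) (adj-sym e ∷ []) ⟩
      walkLength (reverse w) + 1                  ≡⟨ +-comm (walkLength (reverse w)) 1 ⟩
      suc (walkLength (reverse w))                ≡⟨ cong suc (walkLength-reverse w) ⟩
      suc (walkLength w)                          ∎
      where open ≡-Reasoning

    ∈-vertices-reverse⁻ : ∀ {x y u} (w : Walk G x y) → u ∈ vertices (reverse w) → u ∈ vertices w
    ∈-vertices-reverse⁻ []      u∈ = u∈
    ∈-vertices-reverse⁻ (e ∷ w) u∈ with ∈-vertices-++⁻ (reverse w) (adj-sym e ∷ []) u∈
    ... | inj₁ u∈w                 = there (∈-vertices-reverse⁻ w u∈w)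
    ... | inj₂ (here refl)         = there (source∈vertices w)
    ... | inj₂ (there (here refl)) = here refl

  module LocallyFinite
    (_≟_ : DecidableEquality (V G))
    (neighbours : V G → List (V G))
    (neighbours-sound : ∀ {u w} → w ∈ neighbours u → E G u w)
    (neighbours-complete : ∀ {u w} → E G u w → w ∈ neighbours u) where

    WalkWithin : ℕ → V G → V G → Set
    WalkWithin n x y = Σ (Walk G x y) λ w → walkLength w ≤ n

    walkWithin? : ∀ n x y → Dec (WalkWithin n x y)
    walkWithin? zero x y with x ≟ y
    ... | yes refl = yes ([] , z≤n)
    ... | no x≢y   = no λ { ([] , _) → x≢y refl ; (_ ∷ _ , ()) }
    walkWithin? (suc n) x y with x ≟ y
    ... | yes refl = yes ([] , z≤n)
    ... | no x≢y with any? (λ u → walkWithin? n u y) (neighbours x)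
    ...   | yes via with find via
    ...     | _ , u∈ , w , w≤n = yes (neighbours-sound u∈ ∷ w , s≤s w≤n)
    walkWithin? (suc n) x y | no x≢y | no none =
      no λ { ([] , _) → x≢y refl ; (e ∷ w , s≤s w≤n) → none (lose (neighbours-complete e) (w , w≤n)) }

    minimal-walk-within : ∀ {x y} n → WalkWithin n x y → Σ (Walk G x y) IsMinimal
    minimal-walk-within zero (w , w≤0) = w , λ _ → ≤-trans w≤0 z≤n
    minimal-walk-within {x} {y} (suc n) (w , w≤1+n) with walkWithin? n x y
    ... | yes shorter = minimal-walk-within n shorter
    ... | no none     = w , λ w′ → ≤-trans w≤1+n (≰⇒> λ w′≤n → none (w′ , w′≤n))

    minimal-walk : ∀ {x y} → Walk G x y → Σ (Walk G x y) IsMinimal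
    minimal-walk w = minimal-walk-within (walkLength w) (w , ≤-refl)

module Visibility (G : Graph) where

  open Walks G

  HasShortestWalks : Set
  HasShortestWalks = ∀ x y → Σ (Walk G x y) IsMinimal

  NotInAnyTotalMutualVisibilitySet : V G → Set
  NotInAnyTotalMutualVisibilitySet v = ∀ X → v ∈ X → ¬ (∀ x y → Visible G X x y)

  visible-along : ∀ {X x y} (P : Walk G x y) → IsMinimal P →
                  (∀ u → u ∈ vertices P → u ∈ X → u ≡ x ⊎ u ≡ y) → Visible G X x y
  visible-along P min clear = P , minimal⇒shortestPath P min , clear

  []-isTotalMutualVisibilitySet : HasShortestWalks → IsTotalMutualVisibilitySet G []
  []-isTotalMutualVisibilitySet shortest =
    AllPairs.[] , λ x y → visible-along (proj₁ (shortest x y)) (proj₂ (shortest x y)) λ _ _ ()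

  μt≡0 : HasShortestWalks → (∀ v → NotInAnyTotalMutualVisibilitySet v) → MuT≡ G 0
  μt≡0 shortest excluded = ([] , []-isTotalMutualVisibilitySet shortest , refl) , bound
    where
    bound : ∀ X → IsTotalMutualVisibilitySet G X → length X ≤ 0
    bound []      _         = z≤n
    bound (v ∷ X) (_ , vis) = ⊥-elim (excluded v (v ∷ X) (here refl) vis)

  singleton⇒μt≢0 : ∀ {v} → IsTotalMutualVisibilitySet G (v ∷ []) → ¬ MuT≡ G 0
  singleton⇒μt≢0 tmv (_ , bound) with bound _ tmv
  ... | ()

  -- A shortest x,y-path P avoiding v would give F y ≤ F x + |P| ≤ F x + |W|.
  ¬visible-across : ∀ {v x y X} (F : V G → ℕ) →
    (∀ {u w} → E G u w → u ≢ v → w ≢ v → F w ≤ suc (F u)) →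
    x ≢ v → y ≢ v → (W : Walk G x y) → F x + walkLength W < F y → v ∈ X → ¬ Visible G X x y
  ¬visible-across {v} {x} F lip x≢v y≢v W gap v∈X (P , (_ , min) , clear) =
    <-irrefl refl (<-≤-trans gap (≤-trans (lipschitz-bound F (_≢ v) lip P avoids)
                                          (+-monoʳ-≤ (F x) (min W))))
    where
    avoids : Avoids v P
    avoids u u∈ refl with clear u u∈ v∈X
    ... | inj₁ refl = x≢v refl
    ... | inj₂ refl = y≢v refl

  module Bypass
    (v : V G) (_≟_ : DecidableEquality (V G)) (adj-irrefl : ∀ {u} → E G u u → ⊥)
    (detour : ∀ {u w} → E G u v → E G v w →
       Σ (Walk G u w) λ d → walkLength d ≤ 2 × Avoids v d) where

    bypass : ∀ {x y} (W : Walk G x y) → x ≢ v → y ≢ v →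
      Σ (Walk G x y) λ W′ → walkLength W′ ≤ walkLength W × Avoids v W′
    bypass-from : ∀ {x y} → E G x v → (W : Walk G v y) → x ≢ v → y ≢ v →
      Σ (Walk G x y) λ W′ → walkLength W′ ≤ suc (walkLength W) × Avoids v W′

    bypass [] x≢v _ = [] , z≤n , λ { _ (here refl) → x≢v }
    bypass (_∷_ {y = z} e W) x≢v y≢v with z ≟ v
    ... | yes refl = bypass-from e W x≢v y≢v
    ... | no z≢v with bypass W z≢v y≢v
    ...   | W′ , W′≤W , avoids =
      e ∷ W′ , s≤s W′≤W , λ { _ (here refl) → x≢v ; u (there u∈) → avoids u u∈ }

    bypass-from e []       _ y≢v = ⊥-elim (y≢v refl)
    bypass-from e (e′ ∷ W) x≢v y≢v with detour e e′ | bypass W (λ { refl → adj-irrefl e′ }) y≢v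
    ... | d , d≤2 , d-avoids | W′ , W′≤W , W′-avoids =
      d ++ʷ W′ ,
      ≤-trans (≤-reflexive (walkLength-++ d W′)) (+-mono-≤ d≤2 W′≤W) ,
      λ u u∈ → [ d-avoids u , W′-avoids u ]′ (∈-vertices-++⁻ d W′ u∈)

    singleton-isTotalMutualVisibilitySet :
      HasShortestWalks → IsTotalMutualVisibilitySet G (v ∷ [])
    singleton-isTotalMutualVisibilitySet shortest = All.[] AllPairs.∷ AllPairs.[] , visible
      where
      visible : ∀ x y → Visible G (v ∷ []) x y
      visible x y with shortest x y | x ≟ v | y ≟ v
      ... | P , min | yes refl | _        = visible-along P min λ { _ _ (here refl) → inj₁ refl }
      ... | P , min | no _     | yes refl = visible-along P min λ { _ _ (here refl) → inj₂ refl }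
      ... | P , min | no x≢v   | no y≢v with bypass P x≢v y≢v
      ...   | P′ , P′≤P , avoids = visible-along P′ (λ w′ → ≤-trans P′≤P (min w′))
                                     λ { u u∈ (here refl) → ⊥-elim (avoids u u∈ refl) }

WithinOne : ℕ → ℕ → Set
WithinOne a b = a ≤ suc b × b ≤ suc a

withinOne-suc : ∀ a → WithinOne a (suc a)
withinOne-suc a = m≤n⇒m≤1+n (n≤1+n a) , ≤-refl

withinOne-sym : ∀ {a b} → WithinOne a b → WithinOne b a
withinOne-sym (a≤ , b≤) = b≤ , a≤

withinOne-+ : ∀ c {a b} → WithinOne a b → WithinOne (c + a) (c + b)
withinOne-+ c {a} {b} (a≤ , b≤) =
  ≤-trans (+-monoʳ-≤ c a≤) (≤-reflexive (+-suc c b)) ,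
  ≤-trans (+-monoʳ-≤ c b≤) (≤-reflexive (+-suc c a))

withinOne-⊓ : ∀ m q → WithinOne (suc m ⊓ q) (m ⊓ q)
withinOne-⊓ zero    zero    = z≤n , z≤n
withinOne-⊓ (suc m) zero    = z≤n , z≤n
withinOne-⊓ zero    (suc q) = ≤-refl , z≤n
withinOne-⊓ (suc m) (suc q) = Product.map s≤s s≤s (withinOne-⊓ m q)

m<n⇒n∸m≡1+n∸1+m : ∀ {m n} → m < n → n ∸ m ≡ suc (n ∸ suc m)
m<n⇒n∸m≡1+n∸1+m {zero}  {suc n} _         = refl
m<n⇒n∸m≡1+n∸1+m {suc m} {suc n} (s≤s m<n) = m<n⇒n∸m≡1+n∸1+m m<n

module ThetaGraph {k : ℕ} (p : Fin (suc k) → ℕ) (p≥1 : ∀ i → 1 ≤ p i) where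

  open Walks (Theta p) public
  open Visibility (Theta p) public

  p≡1+p∸1 : ∀ i → p i ≡ suc (p i ∸ 1)
  p≡1+p∸1 i with p i | p≥1 i
  ... | suc n | _ = refl

  p∸1≢p : ∀ i → p i ∸ 1 ≢ p i
  p∸1≢p i eq = 1+n≢n (sym (trans eq (p≡1+p∸1 i)))

  <p⇒≤p∸1 : ∀ {i m} → m < p i → m ≤ p i ∸ 1
  <p⇒≤p∸1 {i} m<p = ≤-pred (≤-trans m<p (≤-reflexive (p≡1+p∸1 i)))

  -- Positions beyond p i are sent to b.
  vertexAt : Fin (suc k) → ℕ → ThetaV p
  vertexAt i zero = va
  vertexAt i (suc m) with m <? p i ∸ 1
  ... | yes m<p∸1 = inner i (fromℕ< m<p∸1)
  ... | no _      = vb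

  vertexAt-onPath : ∀ i m → m ≤ p i → OnPath p i (vertexAt i m) m
  vertexAt-onPath i zero    _   = onA
  vertexAt-onPath i (suc m) m<p with m <? p i ∸ 1
  ... | yes m<p∸1 = subst (OnPath p i _) (cong suc (toℕ-fromℕ< m<p∸1)) (onInner _)
  ... | no m≮p∸1  = subst (OnPath p i vb) p≡1+m onB
    where
    p≡1+m : p i ≡ suc m
    p≡1+m = ≤-antisym (≤-trans (≤-reflexive (p≡1+p∸1 i)) (s≤s (≮⇒≥ m≮p∸1))) m<p

  vertexAt-end : ∀ i m → m ≡ p i → vertexAt i m ≡ vb
  vertexAt-end i zero    m≡p = ⊥-elim (<-irrefl m≡p (p≥1 i))
  vertexAt-end i (suc m) m≡p with m <? p i ∸ 1
  ... | yes m<p∸1 = ⊥-elim (<-irrefl (suc-injective (trans m≡p (p≡1+p∸1 i))) m<p∸1)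
  ... | no _      = refl

  onPath-b : ∀ i → OnPath p i vb (suc (p i ∸ 1))
  onPath-b i = subst (OnPath p i vb) (p≡1+p∸1 i) onB

  onPath⇒≤ : ∀ {i u m} → OnPath p i u m → m ≤ p i
  onPath⇒≤ onA             = z≤n
  onPath⇒≤ onB             = ≤-refl
  onPath⇒≤ {i} (onInner j) = ≤-trans (toℕ<n j) (m∸n≤m (p i) 1)

  onPath⇒<p : ∀ {i m j} → OnPath p i (inner i j) m → m < p i
  onPath⇒<p {i} (onInner j) = ≤-trans (s≤s (toℕ<n j)) (≤-reflexive (sym (p≡1+p∸1 i)))

  onPath⇒vertexAt : ∀ {i u m} → OnPath p i u m → u ≡ vertexAt i m
  onPath⇒vertexAt onA = refl
  onPath⇒vertexAt {i} onB = sym (vertexAt-end i (p i) refl)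
  onPath⇒vertexAt {i} (onInner j) with toℕ j <? p i ∸ 1
  ... | yes j<p∸1 = cong (inner i) (sym (fromℕ<-toℕ j j<p∸1))
  ... | no j≮p∸1  = ⊥-elim (j≮p∸1 (toℕ<n j))

  onPath-position-unique : ∀ {i u m n} → OnPath p i u m → OnPath p i u n → m ≡ n
  onPath-position-unique onA         onA          = refl
  onPath-position-unique onB         onB          = refl
  onPath-position-unique (onInner j) (onInner .j) = refl

  onPath-vertex-unique : ∀ {i u w m} → OnPath p i u m → OnPath p i w m → u ≡ w
  onPath-vertex-unique ou ow = trans (onPath⇒vertexAt ou) (sym (onPath⇒vertexAt ow))

  onPath-distinct : ∀ {i u w m n} → OnPath p i u m → OnPath p i w n → m ≢ n → u ≢ w
  onPath-distinct ou ow m≢n refl = m≢n (onPath-position-unique ou ow)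

  onPath-inner⇒≡ : ∀ {i i′ j m} → OnPath p i′ (inner i j) m → i′ ≡ i
  onPath-inner⇒≡ (onInner j) = refl

  onSomePath : ∀ u → ∃₂ λ i m → OnPath p i u m
  onSomePath va          = Fin.zero , 0 , onA
  onSomePath vb          = Fin.zero , p Fin.zero , onB
  onSomePath (inner i j) = i , suc (toℕ j) , onInner j

  adj-sym : ∀ {u w} → ThetaAdj p u w → ThetaAdj p w u
  adj-sym (i , n , e) = i , n , Sum.swap e

  adj-irrefl : ∀ {u} → ThetaAdj p u u → ⊥
  adj-irrefl (i , n , inj₁ (ou , ou′)) = <-irrefl (onPath-position-unique ou ou′) (n<1+n n)
  adj-irrefl (i , n , inj₂ (ou , ou′)) = <-irrefl (onPath-position-unique ou ou′) (n<1+n n)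

  open Undirected adj-sym public

  _≟V_ : DecidableEquality (ThetaV p)
  va ≟V va = yes refl
  va ≟V vb = no λ ()
  va ≟V inner _ _ = no λ ()
  vb ≟V va = no λ ()
  vb ≟V vb = yes refl
  vb ≟V inner _ _ = no λ ()
  inner _ _ ≟V va = no λ ()
  inner _ _ ≟V vb = no λ ()
  inner i j ≟V inner i′ j′ with i ≟ᶠ i′
  ... | no i≢i′ = no λ { refl → i≢i′ refl }
  ... | yes refl with j ≟ᶠ j′
  ...   | yes refl = yes refl
  ...   | no j≢j′  = no λ { refl → j≢j′ refl }

  neighbours : ThetaV p → List (ThetaV p)
  neighbours va          = map (λ i → vertexAt i 1) (allFin (suc k))
  neighbours vb          = map (λ i → vertexAt i (p i ∸ 1)) (allFin (suc k))
  neighbours (inner i j) = vertexAt i (toℕ j) ∷ vertexAt i (2 + toℕ j) ∷ []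

  neighbours-sound : ∀ {u w} → w ∈ neighbours u → ThetaAdj p u w
  neighbours-sound {va} w∈ with ∈-map⁻ (λ i → vertexAt i 1) w∈
  ... | i , _ , refl = i , 0 , inj₁ (onA , vertexAt-onPath i 1 (p≥1 i))
  neighbours-sound {vb} w∈ with ∈-map⁻ (λ i → vertexAt i (p i ∸ 1)) w∈
  ... | i , _ , refl = i , p i ∸ 1 , inj₂ (vertexAt-onPath i (p i ∸ 1) (m∸n≤m (p i) 1) , onPath-b i)
  neighbours-sound {inner i j} (here refl) =
    i , toℕ j , inj₂ (vertexAt-onPath i (toℕ j) (≤-trans (n≤1+n _) (onPath⇒≤ (onInner j))) , onInner j)
  neighbours-sound {inner i j} (there (here refl)) =
    i , suc (toℕ j) , inj₁ (onInner j , vertexAt-onPath i (2 + toℕ j) (onPath⇒<p (onInner j)))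

  neighbours-complete : ∀ {u w} → ThetaAdj p u w → w ∈ neighbours u
  neighbours-complete (i , n , inj₁ (onA , ow)) =
    subst (_∈ neighbours va) (sym (onPath⇒vertexAt ow)) (∈-map⁺ (λ i → vertexAt i 1) (∈-allFin i))
  neighbours-complete (i , n , inj₁ (onB , ow)) = ⊥-elim (<-irrefl refl (onPath⇒≤ ow))
  neighbours-complete (i , n , inj₁ (onInner j , ow)) = there (here (onPath⇒vertexAt ow))
  neighbours-complete (i , n , inj₂ (ow , ou)) = predecessor∈neighbours ow ou refl
    where
    predecessor∈neighbours : ∀ {u w m} → OnPath p i w n → OnPath p i u m → m ≡ suc n → w ∈ neighbours u
    predecessor∈neighbours ow onB p≡1+n =
      subst (_∈ neighbours vb)
        (sym (trans (onPath⇒vertexAt ow) (sym (cong (λ m → vertexAt i (m ∸ 1)) p≡1+n))))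
        (∈-map⁺ (λ i → vertexAt i (p i ∸ 1)) (∈-allFin i))
    predecessor∈neighbours ow (onInner j) refl = here (onPath⇒vertexAt ow)

  adj-inner : ∀ {u i j} → ThetaAdj p u (inner i j) →
              u ≡ vertexAt i (toℕ j) ⊎ u ≡ vertexAt i (2 + toℕ j)
  adj-inner e with neighbours-complete (adj-sym e)
  ... | here u≡        = inj₁ u≡
  ... | there (here u≡) = inj₂ u≡

  walkToA : ∀ i m → m ≤ p i → Walk (Theta p) (vertexAt i m) va
  walkToA i zero    _   = []
  walkToA i (suc m) m<p =
    (i , m , inj₂ (vertexAt-onPath i m m≤p , vertexAt-onPath i (suc m) m<p)) ∷ walkToA i m m≤p
    where
    m≤p : m ≤ p i
    m≤p = ≤-trans (n≤1+n m) m<p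

  connecting-walk : ∀ x y → Walk (Theta p) x y
  connecting-walk x y = toA x ++ʷ reverse (toA y)
    where
    toA : ∀ u → Walk (Theta p) u va
    toA u with onSomePath u
    ... | i , m , ou =
      subst (λ z → Walk (Theta p) z va) (sym (onPath⇒vertexAt ou)) (walkToA i m (onPath⇒≤ ou))

  open LocallyFinite _≟V_ neighbours neighbours-sound neighbours-complete

  hasShortestWalks : HasShortestWalks
  hasShortestWalks x y = minimal-walk (connecting-walk x y)

  -- h i m is the value at position m of the i-th path; Good i m holds unless v sits there.
  module PathPotential
    (v : ThetaV p) (h : Fin (suc k) → ℕ → ℕ) (Good : Fin (suc k) → ℕ → Set)
    (onPath⇒Good : ∀ {i u m} → OnPath p i u m → u ≢ v → Good i m)
    (h-step : ∀ i m → suc m ≤ p i → Good i m → Good i (suc m) → WithinOne (h i (suc m)) (h i m))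
    (h-at-a : va ≢ v → ∀ i → h i 0 ≡ h Fin.zero 0)
    (h-at-b : vb ≢ v → ∀ i → h i (p i) ≡ h Fin.zero (p Fin.zero)) where

    F : ThetaV p → ℕ
    F va          = h Fin.zero 0
    F vb          = h Fin.zero (p Fin.zero)
    F (inner i j) = h i (suc (toℕ j))

    F-onPath : ∀ {i u m} → OnPath p i u m → u ≢ v → F u ≡ h i m
    F-onPath {i} onA         a≢v = sym (h-at-a a≢v i)
    F-onPath {i} onB         b≢v = sym (h-at-b b≢v i)
    F-onPath     (onInner j) _   = refl

    F-lipschitz : ∀ {u w} → ThetaAdj p u w → u ≢ v → w ≢ v → F w ≤ suc (F u)
    F-lipschitz (i , m , inj₁ (ou , ow)) u≢v w≢v rewrite F-onPath ou u≢v | F-onPath ow w≢v =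
      proj₁ (h-step i m (onPath⇒≤ ow) (onPath⇒Good ou u≢v) (onPath⇒Good ow w≢v))
    F-lipschitz (i , m , inj₂ (ow , ou)) u≢v w≢v rewrite F-onPath ou u≢v | F-onPath ow w≢v =
      proj₂ (h-step i m (onPath⇒≤ ou) (onPath⇒Good ow w≢v) (onPath⇒Good ou u≢v))

    excluded : ∀ {x y} (W : Walk (Theta p) x y) → x ≢ v → y ≢ v →
               F x + walkLength W < F y → NotInAnyTotalMutualVisibilitySet v
    excluded W x≢v y≢v gap X v∈X vis = ¬visible-across F F-lipschitz x≢v y≢v W gap v∈X (vis _ _)

  module NextToA (i : Fin (suc k)) (2≤p : 2 ≤ p i) where

    v : ThetaV p
    v = inner i (fromℕ< (∸-monoˡ-≤ 1 2≤p))

    v-onPath : OnPath p i v 1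
    v-onPath = subst (OnPath p i v) (cong suc (toℕ-fromℕ< _)) (onInner _)

    adj-v : ∀ {u} → ThetaAdj p u v → u ≡ va ⊎ u ≡ vertexAt i 2
    adj-v e = Sum.map (λ u≡ → trans u≡ (cong (vertexAt i) position≡0))
                      (λ u≡ → trans u≡ (cong (λ t → vertexAt i (2 + t)) position≡0))
                      (adj-inner e)
      where
      position≡0 : toℕ (fromℕ< (∸-monoˡ-≤ 1 2≤p)) ≡ 0
      position≡0 = toℕ-fromℕ< _

    vertexAt2≢v : vertexAt i 2 ≢ v
    vertexAt2≢v = onPath-distinct (vertexAt-onPath i 2 2≤p) v-onPath λ ()

    singleton-isTotalMutualVisibilitySet : ∀ {R} → vertexAt i 2 ≡ R →
      (D : Walk (Theta p) va R) → walkLength D ≤ 2 → Avoids v D →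
      IsTotalMutualVisibilitySet (Theta p) (v ∷ [])
    singleton-isTotalMutualVisibilitySet refl D D≤2 D-avoids =
      Bypass.singleton-isTotalMutualVisibilitySet v _≟V_ adj-irrefl detour hasShortestWalks
      where
      detour : ∀ {u w} → ThetaAdj p u v → ThetaAdj p v w →
               Σ (Walk (Theta p) u w) λ d → walkLength d ≤ 2 × Avoids v d
      detour e e′ with adj-v e | adj-v (adj-sym e′)
      ... | inj₁ refl | inj₁ refl = [] , z≤n , λ { _ (here refl) () }
      ... | inj₂ refl | inj₂ refl = [] , z≤n , λ { _ (here refl) → vertexAt2≢v }
      ... | inj₁ refl | inj₂ refl = D , D≤2 , D-avoids
      ... | inj₂ refl | inj₁ refl =
        reverse D , subst (_≤ 2) (sym (walkLength-reverse D)) D≤2 ,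
        λ u u∈ → D-avoids u (∈-vertices-reverse⁻ D u∈)

pred+pred≥3 : ∀ {a b} → 1 ≤ a → 1 ≤ b → 5 ≤ a + b → 3 ≤ (a ∸ 1) + (b ∸ 1)
pred+pred≥3 {suc a} {suc b} _ _ 5≤a+b =
  ≤-pred (≤-pred (≤-trans 5≤a+b (≤-reflexive (cong suc (+-suc a b)))))

distance-past≥3 : ∀ q P t → 2 + t ≤ P → 5 ≤ q + P → 3 ≤ t + q + (P ∸ (2 + t))
distance-past≥3 q P t 2+t≤P 5≤q+P = ≤-pred (≤-pred (begin
  5                         ≤⟨ 5≤q+P ⟩
  q + P                     ≡⟨ cong (q +_) (m+[n∸m]≡n 2+t≤P) ⟨
  q + (2 + t + (P ∸ (2 + t))) ≡⟨ rearrange q t (P ∸ (2 + t)) ⟩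
  2 + (t + q + (P ∸ (2 + t))) ∎))
  where
  open ≤-Reasoning
  rearrange : ∀ q t r → q + (2 + t + r) ≡ 2 + (t + q + r)
  rearrange = solve-∀

Condition : ℕ → ℕ → Set
Condition a b = (a ≡ 1 × b ≥ 4) ⊎ (a ≡ 2 × b ≥ 3) ⊎ a ≥ 3

condition⇒5≤+ : ∀ {a b} → 2 ≤ b → Condition a b → 5 ≤ a + b
condition⇒5≤+ _   (inj₁ (refl , b≥4))        = s≤s b≥4
condition⇒5≤+ _   (inj₂ (inj₁ (refl , b≥3))) = s≤s (s≤s b≥3)
condition⇒5≤+ 2≤b (inj₂ (inj₂ a≥3))          = +-mono-≤ a≥3 2≤b

5≤+⇒condition : ∀ {a b} → 1 ≤ a → 5 ≤ a + b → Condition a b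
5≤+⇒condition {1}                 _ 5≤1+b = inj₁ (refl , ≤-pred 5≤1+b)
5≤+⇒condition {2}                 _ 5≤2+b = inj₂ (inj₁ (refl , ≤-pred (≤-pred 5≤2+b)))
5≤+⇒condition {suc (suc (suc _))} _ _     = inj₂ (inj₂ (s≤s (s≤s (s≤s z≤n))))

small-cases : ∀ {a b} → 1 ≤ a → 2 ≤ b → a + b < 5 →
              (a ≡ 1 × b ≡ 2) ⊎ (a ≡ 1 × b ≡ 3) ⊎ (a ≡ 2 × b ≡ 2)
small-cases {1} {2} _ _ _ = inj₁ (refl , refl)
small-cases {1} {3} _ _ _ = inj₂ (inj₁ (refl , refl))
small-cases {2} {2} _ _ _ = inj₂ (inj₂ (refl , refl))
small-cases {_} {1} _ (s≤s ()) _
small-cases {1} {suc (suc (suc (suc _)))} _ _ (s≤s (s≤s (s≤s (s≤s (s≤s ())))))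
small-cases {2} {suc (suc (suc _))}       _ _ (s≤s (s≤s (s≤s (s≤s (s≤s ())))))
small-cases {suc (suc (suc _))} _ 2≤b a+b<5 =
  ⊥-elim (<⇒≱ a+b<5 (+-mono-≤ (s≤s (s≤s (s≤s z≤n))) 2≤b))

module SortedTheta {k : ℕ} (p : Fin (2 + k) → ℕ)
  (p-mono : ∀ i j → i Fin.≤ j → p i ≤ p j)
  (p₁≥1 : 1 ≤ p Fin.zero) (p₂≥2 : 2 ≤ p (Fin.suc Fin.zero)) where

  i₁ i₂ : Fin (2 + k)
  i₁ = Fin.zero
  i₂ = Fin.suc Fin.zero

  p≥1 : ∀ i → 1 ≤ p i
  p≥1 i = ≤-trans p₁≥1 (p-mono i₁ i z≤n)

  open ThetaGraph p p≥1

  a—b : ∀ i → p i ≡ 1 → ThetaAdj p va vb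
  a—b i p≡1 = i , 0 , inj₁ (onA , subst (OnPath p i vb) p≡1 onB)

  singleton-if-small : (p i₁ ≡ 1 × p i₂ ≡ 2) ⊎ (p i₁ ≡ 1 × p i₂ ≡ 3) ⊎ (p i₁ ≡ 2 × p i₂ ≡ 2) →
                       Σ (ThetaV p) λ v → IsTotalMutualVisibilitySet (Theta p) (v ∷ [])
  singleton-if-small (inj₁ (p₁≡1 , p₂≡2)) =
    v , singleton-isTotalMutualVisibilitySet (vertexAt-end i₂ 2 (sym p₂≡2)) (a—b i₁ p₁≡1 ∷ []) (s≤s z≤n)
          λ { _ (here refl) () ; _ (there (here refl)) () }
    where open NextToA i₂ p₂≥2
  singleton-if-small (inj₂ (inj₁ (p₁≡1 , p₂≡3))) =
    v , singleton-isTotalMutualVisibilitySet refl (a—b i₁ p₁≡1 ∷ b—R ∷ []) ≤-refl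
          λ { _ (here refl) () ; _ (there (here refl)) () ; _ (there (there (here refl))) → vertexAt2≢v }
    where
    open NextToA i₂ p₂≥2
    b—R : ThetaAdj p vb (vertexAt i₂ 2)
    b—R = i₂ , 2 , inj₂ (vertexAt-onPath i₂ 2 p₂≥2 , subst (OnPath p i₂ vb) p₂≡3 onB)
  singleton-if-small (inj₂ (inj₂ (p₁≡2 , p₂≡2))) =
    v , singleton-isTotalMutualVisibilitySet (vertexAt-end i₁ 2 (sym p₁≡2)) (a—c ∷ c—b ∷ []) ≤-refl
          λ { _ (here refl) () ; _ (there (here refl)) → c≢v ; _ (there (there (here refl))) () }
    where
    open NextToA i₁ (≤-reflexive (sym p₁≡2))
    c : ThetaV p
    c = vertexAt i₂ 1
    c-onPath : OnPath p i₂ c 1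
    c-onPath = vertexAt-onPath i₂ 1 (p≥1 i₂)
    a—c : ThetaAdj p va c
    a—c = i₂ , 0 , inj₁ (onA , c-onPath)
    c—b : ThetaAdj p c vb
    c—b = i₂ , 1 , inj₁ (c-onPath , subst (OnPath p i₂ vb) p₂≡2 onB)
    c≢v : c ≢ v
    c≢v c≡v with onPath-inner⇒≡ (subst (λ u → OnPath p i₂ u 1) c≡v c-onPath)
    ... | ()

  μt≡0⇒5≤ : MuT≡ (Theta p) 0 → 5 ≤ p i₁ + p i₂
  μt≡0⇒5≤ μ≡0 with 5 ≤? p i₁ + p i₂
  ... | yes 5≤p₁+p₂ = 5≤p₁+p₂
  ... | no 5≰p₁+p₂ with singleton-if-small (small-cases p₁≥1 p₂≥2 (≰⇒> 5≰p₁+p₂))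
  ...   | _ , tmv = ⊥-elim (singleton⇒μt≢0 tmv μ≡0)

  -- In each case F is the distance from x in Θ − v (for inner v, a lower bound for it).
  module Excluded (5≤p₁+p₂ : 5 ≤ p i₁ + p i₂) where

    module AtA where

      h : Fin (2 + k) → ℕ → ℕ
      h Fin.zero    m = m ∸ 1
      h (Fin.suc i) m = (p i₁ ∸ 1) + (p (Fin.suc i) ∸ m)

      good : ∀ {i u m} → OnPath p i u m → u ≢ va → 1 ≤ m
      good     onA         u≢a = ⊥-elim (u≢a refl)
      good {i} onB         _   = p≥1 i
      good     (onInner j) _   = s≤s z≤n

      step : ∀ i m → suc m ≤ p i → 1 ≤ m → 1 ≤ suc m → WithinOne (h i (suc m)) (h i m)
      step Fin.zero    (suc m) _   _ _ = withinOne-sym (withinOne-suc m)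
      step (Fin.suc i) m       m<p _ _ rewrite m<n⇒n∸m≡1+n∸1+m m<p =
        withinOne-+ (p i₁ ∸ 1) (withinOne-suc _)

      at-b : vb {p = p} ≢ va → ∀ i → h i (p i) ≡ h i₁ (p i₁)
      at-b _ Fin.zero    = refl
      at-b _ (Fin.suc i) = trans (cong (p i₁ ∸ 1 +_) (n∸n≡0 (p (Fin.suc i)))) (+-identityʳ _)

      open PathPotential va h (λ _ m → 1 ≤ m) good step (λ a≢a → ⊥-elim (a≢a refl)) at-b

      excluded-a : NotInAnyTotalMutualVisibilitySet va
      excluded-a = excluded (x—a ∷ a—y ∷ []) x≢a y≢a gap
        where
        x-onPath : OnPath p i₁ (vertexAt i₁ 1) 1
        x-onPath = vertexAt-onPath i₁ 1 (p≥1 i₁)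
        y-onPath : OnPath p i₂ (vertexAt i₂ 1) 1
        y-onPath = vertexAt-onPath i₂ 1 (p≥1 i₂)
        x—a : ThetaAdj p (vertexAt i₁ 1) va
        x—a = i₁ , 0 , inj₂ (onA , x-onPath)
        a—y : ThetaAdj p va (vertexAt i₂ 1)
        a—y = i₂ , 0 , inj₁ (onA , y-onPath)
        x≢a : vertexAt i₁ 1 ≢ va
        x≢a = onPath-distinct x-onPath onA λ ()
        y≢a : vertexAt i₂ 1 ≢ va
        y≢a = onPath-distinct y-onPath onA λ ()
        gap : F (vertexAt i₁ 1) + 2 < F (vertexAt i₂ 1)
        gap rewrite F-onPath x-onPath x≢a | F-onPath y-onPath y≢a =
          pred+pred≥3 (p≥1 i₁) (p≥1 i₂) 5≤p₁+p₂

    module AtB where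

      h : Fin (2 + k) → ℕ → ℕ
      h Fin.zero    m = (p i₁ ∸ 1) ∸ m
      h (Fin.suc i) m = (p i₁ ∸ 1) + m

      good : ∀ {i u m} → OnPath p i u m → u ≢ vb → m < p i
      good {i} onA         _   = p≥1 i
      good     onB         u≢b = ⊥-elim (u≢b refl)
      good     (onInner j) _   = onPath⇒<p (onInner j)

      step : ∀ i m → suc m ≤ p i → m < p i → suc m < p i → WithinOne (h i (suc m)) (h i m)
      step Fin.zero    m _ _ 1+m<p rewrite m<n⇒n∸m≡1+n∸1+m (<p⇒≤p∸1 1+m<p) = withinOne-suc _
      step (Fin.suc i) m _ _ _ = withinOne-+ (p i₁ ∸ 1) (withinOne-sym (withinOne-suc m))

      at-a : va {p = p} ≢ vb → ∀ i → h i 0 ≡ h i₁ 0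
      at-a _ Fin.zero    = refl
      at-a _ (Fin.suc i) = +-identityʳ _

      open PathPotential vb h (λ i m → m < p i) good step at-a (λ b≢b → ⊥-elim (b≢b refl))

      excluded-b : NotInAnyTotalMutualVisibilitySet vb
      excluded-b = excluded (x—b ∷ b—y ∷ []) x≢b y≢b gap
        where
        x-onPath : OnPath p i₁ (vertexAt i₁ (p i₁ ∸ 1)) (p i₁ ∸ 1)
        x-onPath = vertexAt-onPath i₁ (p i₁ ∸ 1) (m∸n≤m _ 1)
        y-onPath : OnPath p i₂ (vertexAt i₂ (p i₂ ∸ 1)) (p i₂ ∸ 1)
        y-onPath = vertexAt-onPath i₂ (p i₂ ∸ 1) (m∸n≤m _ 1)
        x—b : ThetaAdj p (vertexAt i₁ (p i₁ ∸ 1)) vb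
        x—b = i₁ , p i₁ ∸ 1 , inj₁ (x-onPath , onPath-b i₁)
        b—y : ThetaAdj p vb (vertexAt i₂ (p i₂ ∸ 1))
        b—y = i₂ , p i₂ ∸ 1 , inj₂ (y-onPath , onPath-b i₂)
        x≢b : vertexAt i₁ (p i₁ ∸ 1) ≢ vb
        x≢b = onPath-distinct x-onPath onB (p∸1≢p i₁)
        y≢b : vertexAt i₂ (p i₂ ∸ 1) ≢ vb
        y≢b = onPath-distinct y-onPath onB (p∸1≢p i₂)
        gap : F (vertexAt i₁ (p i₁ ∸ 1)) + 2 < F (vertexAt i₂ (p i₂ ∸ 1))
        gap rewrite F-onPath x-onPath x≢b | F-onPath y-onPath y≢b | n∸n≡0 (p i₁ ∸ 1) =
          pred+pred≥3 (p≥1 i₁) (p≥1 i₂) 5≤p₁+p₂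

    shortestOther : Fin (2 + k) → ℕ
    shortestOther Fin.zero    = p i₂
    shortestOther (Fin.suc _) = p i₁

    shortestOther≤ : ∀ i₀ i → i ≢ i₀ → shortestOther i₀ ≤ p i
    shortestOther≤ Fin.zero    Fin.zero    i≢i₀ = ⊥-elim (i≢i₀ refl)
    shortestOther≤ Fin.zero    (Fin.suc i) _    = p-mono i₂ (Fin.suc i) (s≤s z≤n)
    shortestOther≤ (Fin.suc _) i           _    = p-mono i₁ i z≤n

    5≤shortestOther+p : ∀ i₀ → 5 ≤ shortestOther i₀ + p i₀
    5≤shortestOther+p Fin.zero    = ≤-trans 5≤p₁+p₂ (≤-reflexive (+-comm (p i₁) (p i₂)))
    5≤shortestOther+p (Fin.suc i) =
      ≤-trans 5≤p₁+p₂ (+-monoʳ-≤ (p i₁) (p-mono i₂ (Fin.suc i) (s≤s z≤n)))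

    module AtInner (i₀ : Fin (2 + k)) (j : Fin (p i₀ ∸ 1)) where

      t q : ℕ
      t = toℕ j
      q = shortestOther i₀

      2+t≤p : 2 + t ≤ p i₀
      2+t≤p = onPath⇒<p (onInner j)

      along : ℕ → ℕ
      along m with m ≤? t
      ... | yes _ = t ∸ m
      ... | no _  = t + q + (p i₀ ∸ m)

      along-≤ : ∀ {m} → m ≤ t → along m ≡ t ∸ m
      along-≤ {m} m≤t with m ≤? t
      ... | yes _  = refl
      ... | no m≰t = ⊥-elim (m≰t m≤t)

      along-> : ∀ {m} → t < m → along m ≡ t + q + (p i₀ ∸ m)
      along-> {m} t<m with m ≤? t
      ... | yes m≤t = ⊥-elim (<⇒≱ t<m m≤t)
      ... | no _    = refl

      along-step : ∀ m → suc m ≤ p i₀ → suc m ≢ suc t → WithinOne (along (suc m)) (along m)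
      along-step m 1+m≤p 1+m≢1+t with suc m ≤? t | m ≤? t
      ... | yes 1+m≤t | yes _   rewrite m<n⇒n∸m≡1+n∸1+m 1+m≤t = withinOne-suc _
      ... | yes 1+m≤t | no m≰t  = ⊥-elim (m≰t (≤-trans (n≤1+n m) 1+m≤t))
      ... | no 1+m≰t  | yes m≤t = ⊥-elim (1+m≢1+t (cong suc (≤-antisym m≤t (≤-pred (≰⇒> 1+m≰t)))))
      ... | no _      | no _    rewrite m<n⇒n∸m≡1+n∸1+m 1+m≤p = withinOne-+ (t + q) (withinOne-suc _)

      h : Fin (2 + k) → ℕ → ℕ
      h i m with i ≟ᶠ i₀
      ... | yes _ = along m
      ... | no _  = t + (m ⊓ q)

      h-on : ∀ m → h i₀ m ≡ along m
      h-on m with i₀ ≟ᶠ i₀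
      ... | yes _    = refl
      ... | no i₀≢i₀ = ⊥-elim (i₀≢i₀ refl)

      Good : Fin (2 + k) → ℕ → Set
      Good i m = i ≡ i₀ → m ≢ suc t

      good : ∀ {i u m} → OnPath p i u m → u ≢ inner i₀ j → Good i m
      good ou u≢v refl refl = u≢v (onPath-vertex-unique ou (onInner j))

      step : ∀ i m → suc m ≤ p i → Good i m → Good i (suc m) → WithinOne (h i (suc m)) (h i m)
      step i m 1+m≤p _ good-1+m with i ≟ᶠ i₀
      ... | yes refl = along-step m 1+m≤p (good-1+m refl)
      ... | no _     = withinOne-+ t (withinOne-⊓ m q)

      h-at-a : ∀ i → h i 0 ≡ t
      h-at-a i with i ≟ᶠ i₀
      ... | yes _ = along-≤ z≤n
      ... | no _  = +-identityʳ t

      h-at-b : ∀ i → h i (p i) ≡ t + q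
      h-at-b i with i ≟ᶠ i₀
      ... | yes refl = trans (along-> (≤-trans (n≤1+n (suc t)) 2+t≤p))
                             (trans (cong (t + q +_) (n∸n≡0 (p i₀))) (+-identityʳ _))
      ... | no i≢i₀  = cong (t +_) (m≥n⇒m⊓n≡n (shortestOther≤ i₀ i i≢i₀))

      open PathPotential (inner i₀ j) h Good good step
        (λ _ i → trans (h-at-a i) (sym (h-at-a i₁))) (λ _ i → trans (h-at-b i) (sym (h-at-b i₁)))

      excluded-inner : NotInAnyTotalMutualVisibilitySet (inner i₀ j)
      excluded-inner = excluded (x—v ∷ v—y ∷ []) x≢v y≢v gap
        where
        x-onPath : OnPath p i₀ (vertexAt i₀ t) t
        x-onPath = vertexAt-onPath i₀ t (≤-trans (m≤n+m t 2) 2+t≤p)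
        y-onPath : OnPath p i₀ (vertexAt i₀ (2 + t)) (2 + t)
        y-onPath = vertexAt-onPath i₀ (2 + t) 2+t≤p
        x—v : ThetaAdj p (vertexAt i₀ t) (inner i₀ j)
        x—v = i₀ , t , inj₁ (x-onPath , onInner j)
        v—y : ThetaAdj p (inner i₀ j) (vertexAt i₀ (2 + t))
        v—y = i₀ , suc t , inj₁ (onInner j , y-onPath)
        x≢v : vertexAt i₀ t ≢ inner i₀ j
        x≢v = onPath-distinct x-onPath (onInner j) λ t≡1+t → 1+n≢n (sym t≡1+t)
        y≢v : vertexAt i₀ (2 + t) ≢ inner i₀ j
        y≢v = onPath-distinct y-onPath (onInner j) 1+n≢n
        gap : F (vertexAt i₀ t) + 2 < F (vertexAt i₀ (2 + t))
        gap rewrite F-onPath x-onPath x≢v | F-onPath y-onPath y≢v | h-on t | h-on (2 + t)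
                  | along-≤ (≤-refl {t}) | n∸n≡0 t | along-> (n≤1+n (suc t)) =
          distance-past≥3 q (p i₀) t 2+t≤p (5≤shortestOther+p i₀)

    excluded-everywhere : ∀ v → NotInAnyTotalMutualVisibilitySet v
    excluded-everywhere va          = AtA.excluded-a
    excluded-everywhere vb          = AtB.excluded-b
    excluded-everywhere (inner i j) = AtInner.excluded-inner i j

  μt≡0⇔5≤ : MuT≡ (Theta p) 0 ⇔ 5 ≤ p i₁ + p i₂
  μt≡0⇔5≤ = mk⇔ μt≡0⇒5≤ λ 5≤p₁+p₂ → μt≡0 hasShortestWalks (Excluded.excluded-everywhere 5≤p₁+p₂)

corollary3p5 : (k : ℕ) (hk : 2 ≤ k) (p : Fin k → ℕ)
    → (∀ i j → i Fin.≤ j → p i ≤ p j)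
    → 1 ≤ p (first hk)
    → 2 ≤ p (second hk)
    → MuT≡ (Theta p) 0 ⇔
        ((p (first hk) ≡ 1 × p (second hk) ≥ 4)
        ⊎ (p (first hk) ≡ 2 × p (second hk) ≥ 3)
        ⊎ p (first hk) ≥ 3)
corollary3p5 (suc (suc k)) (s≤s (s≤s z≤n)) p p-mono p₁≥1 p₂≥2 =
  ⇔.trans (SortedTheta.μt≡0⇔5≤ p p-mono p₁≥1 p₂≥2) (mk⇔ (5≤+⇒condition p₁≥1) (condition⇒5≤+ p₂≥2))
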